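{- Let $n$ and $m$ be positive integers. The number $x(m,n)$ of partitions of $n$ whose mex equals $m$ is \[x(m,n)=p(n-t_{m-1})-p(n-t_m),\] where $t_k=1+2+\cdots+k$ (with $t_0=0$).
   Context: The mex of a partition $\lambda$ is the smallest positive integer that is not a part of $\lambda$. $p(k)$ is the number of partitions of $k$, with $p(0)=1$ and $p(k)=0$ for $k<0$. -}

module Defs where

open import Data.Nat using (ℕ; zero; suc; _+_; _∸_; _<_; _≥_; _≤ᵇ_; _≡ᵇ_)
open import Data.Bool using (Bool; true; false; _∧_; not; T; if_then_else_)
open import Data.List using (List; []; _∷_; _++_)
open import Data.Nat.ListAction using (sum)
open import Data.Bool.ListAction using (any; all)
open import Data.List.Relation.Unary.All using (All)
open import Data.List.Relation.Unary.Linked using (Linked)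
open import Data.Product using (Σ)
open import Data.Fin using (Fin)
open import Function.Bundles using (_↔_)
open import Relation.Binary.PropositionalEquality using (_≡_)

record Partition (n : ℕ) : Set where
  constructor mkPartition
  field
    parts    : List ℕ
    positive : All (λ x → 0 < x) parts
    sorted   : Linked _≥_ parts
    total    : sum parts ≡ n
open Partition public

elem : ℕ → List ℕ → Bool
elem j xs = any (λ x → j ≡ᵇ x) xs

oneTo : ℕ → List ℕ
oneTo zero    = []
oneTo (suc k) = oneTo k ++ (suc k ∷ [])

hasMex : List ℕ → ℕ → Bool
hasMex xs m = (1 ≤ᵇ m) ∧ not (elem m xs) ∧ all (λ j → elem j xs) (oneTo (m ∸ 1))

HasSize : Set → ℕ → Set
HasSize A k = A ↔ Fin k

tri : ℕ → ℕ
tri zero    = 0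
tri (suc k) = suc k + tri k

-- p(n - t) with the convention p(negative) = 0, given p on ℕ.
pShift : (ℕ → ℕ) → ℕ → ℕ → ℕ
pShift p n t = if t ≤ᵇ n then p (n ∸ t) else 0

-- Let C k n be the partitions of n in which each of 1, 2, …, k occurs as a part.
-- Removing one copy of the part k + 1 is a bijection C (k + 1) (k + 1 + n) ≅ C k n,
-- because a partition is determined by the multiset of its parts; iterating,
-- |C k n| = p (n - t_k).  A partition of n has mex k + 1 exactly when it lies in
-- C k n but not in C (k + 1) n, so x (k + 1, n) = |C k n| - |C (k + 1) n|.

module Submission where

open import Defs
open import Data.Nat using (ℕ; zero; suc; _+_; _∸_; _>_; _<_; _≤_; _≥_; _≤ᵇ_; s≤s; z≤n)
open import Data.Nat.Properties
  using ( ≤-decTotalOrder; ≤-trans; ≤-refl; ≤-irrelevant; <-irrelevant; ≡-irrelevant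
        ; ≡ᵇ⇒≡; ≡⇒≡ᵇ; ≤ᵇ⇒≤; +-cancelˡ-≡; m≤m+n; m≤n⇒m≤1+n; <⇒≱; ≰⇒>; <-irrefl; _≤?_
        ; m≤n⇒∃[o]m+o≡n )
open import Data.Nat.ListAction using (sum)
open import Data.Nat.ListAction.Properties using (sum-↭)
open import Data.Bool using (Bool; true; false; _∧_; not; T)
open import Data.Bool.Properties using (T-∧; T-irrelevant; ∧-identityʳ; ∧-assoc)
open import Data.Bool.ListAction using (all)
open import Data.List using (List; []; _∷_; _++_; [_])
open import Data.List.Membership.Propositional using (_∈_)
open import Data.List.Relation.Unary.Any as Any using (Any; here; there; _─_)
open import Data.List.Relation.Unary.Any.Properties using (any⁺; any⁻)
open import Data.List.Relation.Unary.All as All using (_∷_)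
open import Data.List.Relation.Unary.All.Properties using (─⁺)
open import Data.List.Relation.Unary.AllPairs using (AllPairs; _∷_)
open import Data.List.Relation.Unary.Linked as Linked using (Linked)
open import Data.List.Relation.Unary.Linked.Properties using (Linked⇒AllPairs; AllPairs⇒Linked)
open import Data.List.Relation.Binary.Equality.Propositional using (≋⇒≡)
open import Data.List.Relation.Binary.Permutation.Propositional
  using (_↭_; ↭-refl; ↭-sym; ↭-trans; ↭-prep; ↭-swap; ↭⇒↭ₛ)
open import Data.List.Relation.Binary.Permutation.Propositional.Properties using (∈-resp-↭; drop-∷; All-resp-↭)
open import Relation.Binary.Properties.DecTotalOrder ≤-decTotalOrder using (≥-decTotalOrder; ≥-totalOrder; ≥-trans)
open import Data.List.Sort.InsertionSort.Base ≥-decTotalOrder using (insert)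
open import Data.List.Sort.InsertionSort.Properties ≥-decTotalOrder using (insert-↭; insert-↗)
open import Data.List.Relation.Unary.Sorted.TotalOrder.Properties using (↗↭↗⇒≋)
open import Data.Product using (Σ; _×_; _,_; proj₁; proj₂)
open import Data.Product.Function.Dependent.Propositional using (Σ-↔)
open import Data.Sum using (_⊎_; inj₁; inj₂; fromInj₁)
open import Data.Sum.Properties using (inj₁-injective)
open import Data.Sum.Function.Propositional using (_⊎-↔_)
open import Data.Unit using (⊤; tt)
open import Data.Empty using (⊥; ⊥-elim)
open import Data.Fin using (Fin; zero; suc; punchIn; punchOut)
open import Data.Fin.Properties using (punchInᵢ≢i; punchIn-punchOut; punchOut-punchIn; punchOut-cong; +↔⊎; 1↔⊤)
open import Function using (_∘_; _⇔_; _↔_; Inverse; Equivalence; mk⇔; mk↔ₛ′)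
open import Function.Construct.Composition using (_↔-∘_)
open import Function.Construct.Symmetry using (↔-sym)
open import Function.Construct.Identity using (↔-id)
open import Function.Related.TypeIsomorphisms using (⊎-comm; ⊎-assoc; Σ-distribˡ-⊎)
open import Level using (0ℓ)
open import Relation.Nullary using (yes; no; contradiction)
open import Relation.Binary.PropositionalEquality
  using (_≡_; _≢_; refl; sym; trans; cong; subst; module ≡-Reasoning)

-- Punching the position of inj₂ tt out of Fin (suc n) turns h into a bijection X ↔ Fin n.
module _ {X : Set} {n : ℕ} (h : (X ⊎ ⊤) ↔ Fin (suc n)) where
  open Inverse h

  private
    hole : Fin (suc n)
    hole = to (inj₂ tt)

    hole≢to-inj₁ : ∀ x → hole ≢ to (inj₁ x)
    hole≢to-inj₁ x eq with trans (sym (strictlyInverseʳ _)) (trans (cong from eq) (strictlyInverseʳ _))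
    ... | ()

    from-punchIn≢inj₂ : ∀ k → from (punchIn hole k) ≢ inj₂ tt
    from-punchIn≢inj₂ k eq = punchInᵢ≢i hole k (trans (sym (strictlyInverseˡ _)) (cong to eq))

    unInj₁ : (v : X ⊎ ⊤) → v ≢ inj₂ tt → X
    unInj₁ (inj₁ x) _   = x
    unInj₁ (inj₂ tt) v≢ = ⊥-elim (v≢ refl)

    inj₁-unInj₁ : ∀ v (v≢ : v ≢ inj₂ tt) → inj₁ (unInj₁ v v≢) ≡ v
    inj₁-unInj₁ (inj₁ x) _   = refl
    inj₁-unInj₁ (inj₂ tt) v≢ = ⊥-elim (v≢ refl)

    to′ : X → Fin n
    to′ x = punchOut (hole≢to-inj₁ x)

    from′ : Fin n → X
    from′ k = unInj₁ (from (punchIn hole k)) (from-punchIn≢inj₂ k)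

    to-inj₁-from′ : ∀ k → to (inj₁ (from′ k)) ≡ punchIn hole k
    to-inj₁-from′ k = trans (cong to (inj₁-unInj₁ _ (from-punchIn≢inj₂ k))) (strictlyInverseˡ _)

    to′-from′ : ∀ k → to′ (from′ k) ≡ k
    to′-from′ k = trans (punchOut-cong hole (to-inj₁-from′ k)) (punchOut-punchIn hole)

    from′-to′ : ∀ x → from′ (to′ x) ≡ x
    from′-to′ x = inj₁-injective (begin
      inj₁ (from′ (to′ x))              ≡⟨ inj₁-unInj₁ _ (from-punchIn≢inj₂ (to′ x)) ⟩
      from (punchIn hole (to′ x))       ≡⟨ cong from (punchIn-punchOut (hole≢to-inj₁ x)) ⟩
      from (to (inj₁ x))                ≡⟨ strictlyInverseʳ (inj₁ x) ⟩
      inj₁ x                            ∎)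
      where open ≡-Reasoning

  ⊎⊤↔Fin-suc⇒↔Fin : X ↔ Fin n
  ⊎⊤↔Fin-suc⇒↔Fin = mk↔ₛ′ to′ from′ to′-from′ from′-to′

Fin-suc↔⊎⊤ : ∀ c → Fin (suc c) ↔ (Fin c ⊎ ⊤)
Fin-suc↔⊎⊤ c = ⊎-comm ⊤ (Fin c) ↔-∘ ((1↔⊤ ⊎-↔ ↔-id (Fin c)) ↔-∘ +↔⊎ {1} {c})

⊎Fin↔Fin⇒↔Fin-∸ : {B : Set} (a c : ℕ) → (B ⊎ Fin c) ↔ Fin a → B ↔ Fin (a ∸ c)
⊎Fin↔Fin⇒↔Fin-∸ a zero h =
  h ↔-∘ mk↔ₛ′ inj₁ (fromInj₁ λ ()) (λ { (inj₁ b) → refl ; (inj₂ ()) }) (λ _ → refl)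
⊎Fin↔Fin⇒↔Fin-∸ zero (suc c) h with Inverse.to h (inj₂ zero)
... | ()
⊎Fin↔Fin⇒↔Fin-∸ {B} (suc a) (suc c) h =
  ⊎Fin↔Fin⇒↔Fin-∸ a c (⊎⊤↔Fin-suc⇒↔Fin (h ↔-∘ regroup))
  where
  regroup : ((B ⊎ Fin c) ⊎ ⊤) ↔ (B ⊎ Fin (suc c))
  regroup = (↔-id B ⊎-↔ ↔-sym (Fin-suc↔⊎⊤ c)) ↔-∘ ⊎-assoc 0ℓ B (Fin c) ⊤

Sorted : List ℕ → Set
Sorted = Linked _≥_

elem⇔∈ : ∀ {j xs} → T (elem j xs) ⇔ j ∈ xs
elem⇔∈ {j} = mk⇔ (Any.map (≡ᵇ⇒≡ j _) ∘ any⁻ _ _) (any⁺ _ ∘ Any.map (≡⇒≡ᵇ j _))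

↭-∷-─ : ∀ {A : Set} {x : A} {xs} (x∈xs : x ∈ xs) → xs ↭ x ∷ (xs ─ x∈xs)
↭-∷-─ (here refl)              = ↭-refl
↭-∷-─ {x = x} (there {y} x∈xs) = ↭-trans (↭-prep y (↭-∷-─ x∈xs)) (↭-swap y x ↭-refl)

AllPairs-─⁺ : ∀ {A : Set} {R : A → A → Set} {P : A → Set} {xs} (i : Any P xs) →
              AllPairs R xs → AllPairs R (xs ─ i)
AllPairs-─⁺ (here _)  (_ ∷ rs)   = rs
AllPairs-─⁺ (there i) (rx ∷ rs) = ─⁺ i rx ∷ AllPairs-─⁺ i rs

Sorted-─⁺ : ∀ {x xs} (x∈xs : x ∈ xs) → Sorted xs → Sorted (xs ─ x∈xs)
Sorted-─⁺ x∈xs = AllPairs⇒Linked ∘ AllPairs-─⁺ x∈xs ∘ Linked⇒AllPairs ≥-trans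

sorted-↭⇒≡ : ∀ {xs ys} → Sorted xs → Sorted ys → xs ↭ ys → xs ≡ ys
sorted-↭⇒≡ xs↗ ys↗ xs↭ys = ≋⇒≡ (↗↭↗⇒≋ ≥-totalOrder xs↗ ys↗ (↭⇒↭ₛ xs↭ys))

∈⇒≤sum : ∀ {x xs} → x ∈ xs → x ≤ sum xs
∈⇒≤sum {x} x∈xs = subst (x ≤_) (sym (sum-↭ (↭-∷-─ x∈xs))) (m≤m+n x _)

parts-injective : ∀ {n} {P Q : Partition n} → parts P ≡ parts Q → P ≡ Q
parts-injective {P = mkPartition xs pos↗ xs↗ tot} {mkPartition .xs pos↗′ xs↗′ tot′} refl
  rewrite All.irrelevant <-irrelevant pos↗ pos↗′
        | Linked.irrelevant ≤-irrelevant xs↗ xs↗′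
        | ≡-irrelevant tot tot′ = refl

parts-↭⇒≡ : ∀ {n} {P Q : Partition n} → parts P ↭ parts Q → P ≡ Q
parts-↭⇒≡ {P = P} {Q} = parts-injective ∘ sorted-↭⇒≡ (sorted P) (sorted Q)

module _ {n : ℕ} (j : ℕ) where

  addPart : 0 < j → Partition n → Partition (j + n)
  addPart 0<j Q = mkPartition
    (insert j (parts Q))
    (All-resp-↭ (↭-sym (insert-↭ j _)) (0<j ∷ positive Q))
    (insert-↗ j (sorted Q))
    (trans (sum-↭ (insert-↭ j (parts Q))) (cong (j +_) (total Q)))

  removePart : (P : Partition (j + n)) → j ∈ parts P → Partition n
  removePart P j∈P = mkPartition
    (parts P ─ j∈P)
    (─⁺ j∈P (positive P))
    (Sorted-─⁺ j∈P (sorted P))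
    (+-cancelˡ-≡ j _ _ (trans (sym (sum-↭ (↭-∷-─ j∈P))) (total P)))

  removePart-addPart : ∀ 0<j Q (j∈ : j ∈ parts (addPart 0<j Q)) → removePart (addPart 0<j Q) j∈ ≡ Q
  removePart-addPart 0<j Q j∈ = parts-↭⇒≡ (drop-∷ (↭-trans (↭-sym (↭-∷-─ j∈)) (insert-↭ j (parts Q))))

  addPart-removePart : ∀ 0<j P (j∈P : j ∈ parts P) → addPart 0<j (removePart P j∈P) ≡ P
  addPart-removePart 0<j P j∈P = parts-↭⇒≡ (↭-trans (insert-↭ j _) (↭-sym (↭-∷-─ j∈P)))

  ∈-addPart : ∀ {i} 0<j Q → i ∈ j ∷ parts Q → i ∈ parts (addPart 0<j Q)
  ∈-addPart 0<j Q = ∈-resp-↭ (↭-sym (insert-↭ j _))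

  ∈-removePart : ∀ {i} P (j∈P : j ∈ parts P) → i ≢ j → i ∈ parts P → i ∈ parts (removePart P j∈P)
  ∈-removePart P j∈P i≢j i∈P with ∈-resp-↭ (↭-∷-─ j∈P) i∈P
  ... | here i≡j = contradiction i≡j i≢j
  ... | there i∈ = i∈

containsOneTo : ℕ → List ℕ → Bool
containsOneTo k xs = all (λ j → elem j xs) (oneTo k)

all-∷ʳ : ∀ (f : ℕ → Bool) xs y → all f (xs ++ [ y ]) ≡ all f xs ∧ f y
all-∷ʳ f []       y = ∧-identityʳ (f y)
all-∷ʳ f (x ∷ xs) y = trans (cong (f x ∧_) (all-∷ʳ f xs y)) (sym (∧-assoc (f x) _ (f y)))

containsOneTo-suc : ∀ k xs → containsOneTo (suc k) xs ≡ containsOneTo k xs ∧ elem (suc k) xs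
containsOneTo-suc k xs = all-∷ʳ (λ j → elem j xs) (oneTo k) (suc k)

containsOneTo-suc⇔ : ∀ {k xs} → T (containsOneTo (suc k) xs) ⇔ (T (containsOneTo k xs) × suc k ∈ xs)
containsOneTo-suc⇔ {k} {xs} = mk⇔
  (λ c → let c′ , e = Equivalence.to T-∧ (subst T (containsOneTo-suc k xs) c)
         in c′ , Equivalence.to elem⇔∈ e)
  (λ (c′ , e) → subst T (sym (containsOneTo-suc k xs))
                   (Equivalence.from T-∧ (c′ , Equivalence.from elem⇔∈ e)))

containsOneTo-mono : ∀ k {xs ys} → (∀ {i} → i ≤ k → i ∈ xs → i ∈ ys) →
                     T (containsOneTo k xs) → T (containsOneTo k ys)
containsOneTo-mono zero    _   _ = tt
containsOneTo-mono (suc k) sub c =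
  let c′ , e = Equivalence.to containsOneTo-suc⇔ c
  in Equivalence.from containsOneTo-suc⇔
       (containsOneTo-mono k (sub ∘ m≤n⇒m≤1+n) c′ , sub ≤-refl e)

PartitionContainingOneTo : ℕ → ℕ → Set
PartitionContainingOneTo k n = Σ (Partition n) (λ P → T (containsOneTo k (parts P)))

Σ-T-≡ : ∀ {A : Set} {f : A → Bool} {a b : Σ A (T ∘ f)} → proj₁ a ≡ proj₁ b → a ≡ b
Σ-T-≡ {a = x , s} {.x , t} refl = cong (x ,_) (T-irrelevant s t)

PartitionContainingOneTo-suc↔ : ∀ k n →
  PartitionContainingOneTo (suc k) (suc k + n) ↔ PartitionContainingOneTo k n
PartitionContainingOneTo-suc↔ k n = mk↔ₛ′ remove add
  (λ _ → Σ-T-≡ (removePart-addPart j 0<j _ _))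
  (λ (P , _) → Σ-T-≡ (addPart-removePart j 0<j P _))
  where
  j : ℕ
  j = suc k
  0<j : 0 < j
  0<j = s≤s z≤n

  remove : PartitionContainingOneTo j (j + n) → PartitionContainingOneTo k n
  remove (P , c) =
    let c′ , j∈P = Equivalence.to containsOneTo-suc⇔ c
    in removePart j P j∈P ,
       containsOneTo-mono k (λ i≤k → ∈-removePart j P j∈P (λ { refl → <-irrefl refl (s≤s i≤k) })) c′

  add : PartitionContainingOneTo k n → PartitionContainingOneTo j (j + n)
  add (Q , c) = addPart j 0<j Q ,
    Equivalence.from containsOneTo-suc⇔
      (containsOneTo-mono k (λ _ → ∈-addPart j 0<j Q ∘ there) c , ∈-addPart j 0<j Q (here refl))

module _ (p : ℕ → ℕ) where

  -- suc t ≤ᵇ suc n only reduces to t ≤ᵇ n once t is a constructor.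
  pShift-suc : ∀ n t → pShift p (suc n) (suc t) ≡ pShift p n t
  pShift-suc n zero    = refl
  pShift-suc n (suc t) = refl

  pShift-+ : ∀ a n t → pShift p (a + n) (a + t) ≡ pShift p n t
  pShift-+ zero    n t = refl
  pShift-+ (suc a) n t = trans (pShift-suc (a + n) (a + t)) (pShift-+ a n t)

  pShift-< : ∀ {n t} → n < t → pShift p n t ≡ 0
  pShift-< {n} {t} n<t with t ≤ᵇ n in eq
  ... | false = refl
  ... | true  = contradiction (≤ᵇ⇒≤ t n (subst T (sym eq) tt)) (<⇒≱ n<t)

  module _ (p-size : ∀ n → HasSize (Partition n) (p n)) where

    PartitionContainingOneTo-size : ∀ k n → HasSize (PartitionContainingOneTo k n) (pShift p n (tri k))
    PartitionContainingOneTo-size zero n = p-size n ↔-∘ mk↔ₛ′ proj₁ (_, tt) (λ _ → refl) (λ _ → refl)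
    PartitionContainingOneTo-size (suc k) n with suc k ≤? n
    ... | yes k<n with m≤n⇒∃[o]m+o≡n k<n
    ...   | o , refl = subst (HasSize _) (sym (pShift-+ (suc k) o (tri k)))
                         (PartitionContainingOneTo-size k o ↔-∘ PartitionContainingOneTo-suc↔ k o)
    PartitionContainingOneTo-size (suc k) n | no k≮n =
      subst (HasSize _) (sym (pShift-< (≤-trans (≰⇒> k≮n) (m≤m+n (suc k) (tri k)))))
        (mk↔ₛ′ (⊥-elim ∘ empty) (λ ()) (λ ()) (⊥-elim ∘ empty))
      where
      empty : PartitionContainingOneTo (suc k) n → ⊥
      empty (P , c) = k≮n (subst (suc k ≤_) (total P) (∈⇒≤sum k+1∈P))
        where
        k+1∈P : suc k ∈ parts P
        k+1∈P = proj₂ (Equivalence.to (containsOneTo-suc⇔ {xs = parts P}) c)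

T-split : ∀ a b → T b ↔ (T (not a ∧ b) ⊎ T (b ∧ a))
T-split false false = mk↔ₛ′ (λ ()) (λ { (inj₁ ()) ; (inj₂ ()) }) (λ { (inj₁ ()) ; (inj₂ ()) }) (λ ())
T-split true  false = mk↔ₛ′ (λ ()) (λ { (inj₁ ()) ; (inj₂ ()) }) (λ { (inj₁ ()) ; (inj₂ ()) }) (λ ())
T-split false true  = mk↔ₛ′ inj₁ (λ { (inj₁ tt) → tt ; (inj₂ ()) }) (λ { (inj₁ tt) → refl ; (inj₂ ()) }) (λ _ → refl)
T-split true  true  = mk↔ₛ′ inj₂ (λ { (inj₁ ()) ; (inj₂ tt) → tt }) (λ { (inj₁ ()) ; (inj₂ tt) → refl }) (λ _ → refl)

Σ-T-split : ∀ {A : Set} (f g : A → Bool) →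
            Σ A (T ∘ g) ↔ (Σ A (λ x → T (not (f x) ∧ g x)) ⊎ Σ A (λ x → T (g x ∧ f x)))
Σ-T-split f g = Σ-distribˡ-⊎ ↔-∘ Σ-↔ (↔-id _) (λ {x} → T-split (f x) (g x))

Σ-T-cong : ∀ {A : Set} {f g : A → Bool} → (∀ x → f x ≡ g x) → Σ A (T ∘ f) ↔ Σ A (T ∘ g)
Σ-T-cong f≡g = Σ-↔ (↔-id _) (λ {x} → subst (λ b → T _ ↔ T b) (f≡g x) (↔-id _))

PartitionWithMex : ℕ → ℕ → Set
PartitionWithMex m n = Σ (Partition n) (λ P → T (hasMex (parts P) m))

-- hasMex xs (suc k) reduces to not (elem (suc k) xs) ∧ containsOneTo k xs.
PartitionContainingOneTo-split : ∀ k n →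
  PartitionContainingOneTo k n ↔ (PartitionWithMex (suc k) n ⊎ PartitionContainingOneTo (suc k) n)
PartitionContainingOneTo-split k n =
  (↔-id _ ⊎-↔ Σ-T-cong (λ P → sym (containsOneTo-suc k (parts P))))
    ↔-∘ Σ-T-split (λ P → elem (suc k) (parts P)) (λ P → containsOneTo k (parts P))

proposition5 : (p : ℕ → ℕ) → (∀ k → HasSize (Partition k) (p k)) →
    (m n : ℕ) → m > 0 → n > 0 →
    HasSize (Σ (Partition n) (λ λ′ → T (hasMex (parts λ′) m)))
    (pShift p n (tri (m ∸ 1)) ∸ pShift p n (tri m))
proposition5 p p-size (suc k) n _ _ =
  ⊎Fin↔Fin⇒↔Fin-∸ _ _
    (size k ↔-∘ (↔-sym (PartitionContainingOneTo-split k n) ↔-∘ (↔-id _ ⊎-↔ ↔-sym (size (suc k)))))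
  where
  size : ∀ i → HasSize (PartitionContainingOneTo i n) (pShift p n (tri i))
  size i = PartitionContainingOneTo-size p p-size i n
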